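{- Let $N$ be a natural number that cannot be written as a sum of two squares, and let $\mathcal A,\mathcal B,\mathcal C,\mathcal D,\mathcal E$ be as defined in the context. Then $|\mathcal A|=|\mathcal B|+|\mathcal C|+|\mathcal D|+|\mathcal E|$, where $|\mathcal A|$ is the size of the multiset $\mathcal A$ counted with multiplicity.
   Context: A rectangle $R(a,b)$ (with $a,b$ positive integers) is an $a\times b$ grid of unit square cells with $a$ rows and $b$ columns; it has $ab$ cells, its transpose is $R(a,b)^T=R(b,a)$, and it is a square if $a=b$. A canonical pair for $N$ is an unordered pair of rectangles $\{X,Y\}$ such that each of $X$ and $Y$ has number of rows at most its number of columns, and the total number of cells of $X$ and $Y$ is $N$. Let $\mathcal A$ be the multiset obtained by including, for every canonical pair $\{X,Y\}$ for $N$, the four unordered pairs $\{X,Y\},\{X,Y^T\},\{X^T,Y\},\{X^T,Y^T\}$ (with repetitions counted). Let $\mathcal B,\mathcal C,\mathcal D,\mathcal E$ be the following sets of distinct unordered pairs $\{X,Y\}$ occurring in $\mathcal A$ (each counted once): $\mathcal B$: those in which $X$ and $Y$ have different numbers of columns; $\mathcal C$: those in which $X$ or $Y$ is a square; $\mathcal D$: those in which $X$ and $Y$ have the same number of columns; $\mathcal E$: those with $X=Y^T$. -}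

module Defs where

open import Data.Nat.Base using (ℕ; suc; _+_; _*_; _≤ᵇ_; _<ᵇ_; _≡ᵇ_)
open import Data.Bool.Base using (Bool; true; false; _∧_; _∨_; not; if_then_else_)
open import Data.Product using (_×_; _,_; proj₁; proj₂)
open import Data.List.Base using (List; []; _∷_; map; upTo; concatMap; filterᵇ; deduplicateᵇ; cartesianProduct)

-- A rectangle R(a,b) is represented by (a , b) : a rows, b columns (a,b ≥ 1).
Rect : Set
Rect = ℕ × ℕ

rows cols area : Rect → ℕ
rows = proj₁
cols = proj₂
area r = rows r * cols r

transpose : Rect → Rect
transpose (a , b) = (b , a)

isSquare : Rect → Bool
isSquare (a , b) = a ≡ᵇ b

rectEq : Rect → Rect → Bool
rectEq (a , b) (c , d) = (a ≡ᵇ c) ∧ (b ≡ᵇ d)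

rectLt : Rect → Rect → Bool
rectLt (a , b) (c , d) = (a <ᵇ c) ∨ ((a ≡ᵇ c) ∧ (b <ᵇ d))

-- Unordered pair {X,Y} of rectangles, represented by the ordered pair in
-- normal form (lexicographically smaller component first).
UPair : Set
UPair = Rect × Rect

upair : Rect → Rect → UPair
upair X Y = if rectLt Y X then (Y , X) else (X , Y)

upairEq : UPair → UPair → Bool
upairEq (X , Y) (X' , Y') = rectEq X X' ∧ rectEq Y Y'

range : ℕ → List ℕ
range N = map suc (upTo N)

canonicalRects : ℕ → List Rect
canonicalRects N = filterᵇ (λ r → rows r ≤ᵇ cols r) (cartesianProduct (range N) (range N))

canonicalPairs : ℕ → List UPair
canonicalPairs N =
  filterᵇ (λ p → (area (proj₁ p) + area (proj₂ p) ≡ᵇ N) ∧ not (rectLt (proj₂ p) (proj₁ p)))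
          (cartesianProduct (canonicalRects N) (canonicalRects N))

-- the multiset 𝒜 (as a list, repetitions kept)
four : UPair → List UPair
four (X , Y) = upair X Y ∷ upair X (transpose Y) ∷ upair (transpose X) Y
             ∷ upair (transpose X) (transpose Y) ∷ []

𝒜 : ℕ → List UPair
𝒜 N = concatMap four (canonicalPairs N)

support𝒜 : ℕ → List UPair
support𝒜 N = deduplicateᵇ upairEq (𝒜 N)

ℬ 𝒞 𝒟 ℰ : ℕ → List UPair
ℬ N = filterᵇ (λ p → not (cols (proj₁ p) ≡ᵇ cols (proj₂ p))) (support𝒜 N)
𝒞 N = filterᵇ (λ p → isSquare (proj₁ p) ∨ isSquare (proj₂ p)) (support𝒜 N)
𝒟 N = filterᵇ (λ p → cols (proj₁ p) ≡ᵇ cols (proj₂ p)) (support𝒜 N)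
ℰ N = filterᵇ (λ p → rectEq (proj₁ p) (transpose (proj₂ p))) (support𝒜 N)

module Submission where

-- Sorting each rectangle to rows ≤ columns sends every pair in the support of 𝒜 to the
-- canonical pair it came from, so the support is the disjoint union of the deduplicated
-- blocks {X,Y}, {X,Yᵀ}, {Xᵀ,Y}, {Xᵀ,Yᵀ}. Since ℬ and 𝒟 split the support, the right-hand
-- side counts each pair of the support once, plus once more for each of 𝒞 and ℰ containing
-- it. A block with exactly one square has two distinct pairs, both in 𝒞; a block X = Y has
-- three, of which only {X,Xᵀ} is in ℰ; any other block has four, none in 𝒞 or ℰ (X = Yᵀ is
-- impossible for two wide rectangles). So every block contributes 4, its size in 𝒜. Only a
-- block of two squares would contribute 3, and it needs N = a² + c².

open import Defs
open import Algebra.Properties.CommutativeSemigroup using (interchange; xy∙z≈xz∙y)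
open import Data.Bool.Base using (Bool; true; false; not; _∨_; T; if_then_else_)
open import Data.Bool.Properties using (∨-comm; T-∧)
open import Data.List.Base
  using (List; []; _∷_; _++_; length; filter; filterᵇ; deduplicateᵇ; concatMap; cartesianProduct)
open import Data.List.Membership.Propositional using (_∈_; find)
open import Data.List.Membership.Propositional.Properties
  using (∈-filter⁻; ∈-cartesianProduct⁻; ∈-deduplicate⁻; ∈-concatMap⁻)
open import Data.List.Properties using (length-++; filter-++; filter-all)
open import Data.List.Relation.Binary.Disjoint.Propositional using (Disjoint)
open import Data.List.Relation.Binary.Pointwise using (Pointwise; []; _∷_)
open import Data.List.Relation.Unary.All as All using (All; []; _∷_)
open import Data.List.Relation.Unary.AllPairs using ([]; _∷_)
open import Data.List.Relation.Unary.Any using (here; there)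
open import Data.List.Relation.Unary.Unique.Propositional using (Unique)
import Data.List.Relation.Unary.Unique.Propositional.Properties as Unique
open import Data.Nat.Base using (ℕ; suc; _+_; _*_; _≤_; _<_; _≡ᵇ_)
open import Data.Nat.Properties
  using (_≟_; _≤?_; _<?_; <-cmp; <-asym; <⇒≢; >⇒≢; ≤∧≢⇒<; ≤-antisym; ≤ᵇ⇒≤; ≡ᵇ⇒≡
        ; suc-injective; +-suc; +-commutativeSemigroup)
open import Data.Product using (∃₂; _×_; _,_; proj₁; proj₂; swap)
open import Data.Product.Relation.Binary.Lex.Strict using (×-Lex; ×-decidable; ×-compare)
open import Data.Product.Relation.Binary.Pointwise.NonDependent using (≡×≡⇒≡; ≡⇒≡×≡)
open import Data.Sum using (_⊎_; inj₁; inj₂; [_,_])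
open import Function.Base using (_∘_; _∘₂_; id; _$_)
open import Function.Bundles using (Equivalence; mk⇔)
open import Relation.Binary.Definitions using (DecidableEquality; tri<; tri≈; tri>)
open import Relation.Binary.PropositionalEquality
  using (_≡_; _≢_; refl; sym; trans; cong; cong₂; subst; ≢-sym; module ≡-Reasoning)
open import Relation.Nullary using (¬_; Dec; does; yes; no; contradiction)
open import Relation.Nullary.Decidable
  using (T?; ¬?; map′; _×-dec_; _⊎-dec_; dec-true; dec-false; does-⇔)

open ≡-Reasoning

private variable A B : Set

count : (A → Bool) → List A → ℕ
count q = length ∘ filterᵇ q

count-++ : ∀ q (xs ys : List A) → count q (xs ++ ys) ≡ count q xs + count q ys
count-++ q xs ys = trans (cong length (filter-++ (T? ∘ q) xs ys)) (length-++ (filterᵇ q xs))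

count-values : ∀ {q : A → Bool} {xs bs} → Pointwise (λ x b → q x ≡ b) xs bs →
  count q xs ≡ count id bs
count-values [] = refl
count-values {q = q} {xs = x ∷ _} (refl ∷ qs) with q x
... | true  = cong suc (count-values qs)
... | false = count-values qs

count-complement : ∀ q (xs : List A) → count (not ∘ q) xs + count q xs ≡ length xs
count-complement q [] = refl
count-complement q (x ∷ xs) with q x
... | true  = trans (+-suc _ _) (cong suc (count-complement q xs))
... | false = cong suc (count-complement q xs)

module Deduplication {A : Set} (_≟_ : DecidableEquality A) where

  private
    dedup : List A → List A
    dedup = deduplicateᵇ (does ∘₂ _≟_)

    ≟-sound : ∀ {x y} → T (does (x ≟ y)) → x ≡ y
    ≟-sound {x} {y} with x ≟ y
    ... | yes x≡y = λ _ → x≡y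

  deduplicate-unique : ∀ {xs} → Unique xs → dedup xs ≡ xs
  deduplicate-unique [] = refl
  deduplicate-unique {x ∷ xs} (x∉xs ∷ xs!) = cong (x ∷_) $ begin
    filter x≢? (dedup xs) ≡⟨ cong (filter x≢?) (deduplicate-unique xs!) ⟩
    filter x≢? xs         ≡⟨ filter-all x≢? (All.map (λ x≢y → x≢y ∘ ≟-sound) x∉xs) ⟩
    xs                    ∎
    where x≢? = ¬? ∘ T? ∘ does ∘ (x ≟_)

  deduplicate-++ : ∀ {xs ys} → Disjoint xs ys → dedup (xs ++ ys) ≡ dedup xs ++ dedup ys
  deduplicate-++ {[]} _ = refl
  deduplicate-++ {x ∷ xs} {ys} disjoint = cong (x ∷_) $ begin
    filter x≢? (dedup (xs ++ ys))
      ≡⟨ cong (filter x≢?) (deduplicate-++ (disjoint ∘ λ (y∈xs , y∈ys) → there y∈xs , y∈ys)) ⟩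
    filter x≢? (dedup xs ++ dedup ys)
      ≡⟨ filter-++ x≢? (dedup xs) (dedup ys) ⟩
    filter x≢? (dedup xs) ++ filter x≢? (dedup ys)
      ≡⟨ cong (filter x≢? (dedup xs) ++_) (filter-all x≢? x∉ys) ⟩
    filter x≢? (dedup xs) ++ dedup ys ∎
    where
    x≢? = ¬? ∘ T? ∘ does ∘ (x ≟_)
    x∉ys = All.tabulate λ y∈ys x≡y → disjoint (here (sym (≟-sound x≡y)) , ∈-deduplicate⁻ _ ys y∈ys)

  deduplicate-concatMap : ∀ (label : A → B) (block : B → List A) {ls} → Unique ls →
    (∀ {l x} → l ∈ ls → x ∈ block l → label x ≡ l) →
    dedup (concatMap block ls) ≡ concatMap (dedup ∘ block) ls
  deduplicate-concatMap label block [] _ = refl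
  deduplicate-concatMap label block {l ∷ ls} (l∉ls ∷ ls!) labelled = begin
    dedup (block l ++ concatMap block ls)             ≡⟨ deduplicate-++ disjoint ⟩
    dedup (block l) ++ dedup (concatMap block ls)     ≡⟨ cong (dedup (block l) ++_) rest ⟩
    dedup (block l) ++ concatMap (dedup ∘ block) ls   ∎
    where
    rest = deduplicate-concatMap label block ls! (labelled ∘ there)
    disjoint : Disjoint (block l) (concatMap block ls)
    disjoint (x∈l , x∈ls) with find (∈-concatMap⁻ block x∈ls)
    ... | k , k∈ls , x∈k =
      All.lookup l∉ls k∈ls (trans (sym (labelled (here refl) x∈l)) (labelled (there k∈ls) x∈k))

  deduplicate-abab : ∀ {u v} → u ≢ v → dedup (u ∷ v ∷ u ∷ v ∷ []) ≡ u ∷ v ∷ []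
  deduplicate-abab {u} {v} u≢v
    rewrite dec-false (u ≟ v) u≢v | dec-false (v ≟ u) (≢-sym u≢v)
          | dec-true (v ≟ v) refl | dec-true (u ≟ u) refl = refl

  -- A rewrite only reaches the comparisons exposed so far, hence some are rewritten twice.
  deduplicate-aabb : ∀ {u v} → u ≢ v → dedup (u ∷ u ∷ v ∷ v ∷ []) ≡ u ∷ v ∷ []
  deduplicate-aabb {u} {v} u≢v
    rewrite dec-true (u ≟ u) refl | dec-true (v ≟ v) refl
          | dec-false (u ≟ v) u≢v | dec-false (u ≟ v) u≢v = refl

  deduplicate-abbc : ∀ {u v w} → u ≢ v → u ≢ w → v ≢ w →
    dedup (u ∷ v ∷ v ∷ w ∷ []) ≡ u ∷ v ∷ w ∷ []
  deduplicate-abbc {u} {v} {w} u≢v u≢w v≢w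
    rewrite dec-true (v ≟ v) refl | dec-false (u ≟ v) u≢v | dec-false (v ≟ w) v≢w
          | dec-false (v ≟ w) v≢w | dec-false (u ≟ w) u≢w = refl

IsSquare Oriented Wide : Rect → Set
IsSquare R = rows R ≡ cols R
Oriented R = rows R ≤ cols R
Wide     R = rows R < cols R

-- The decision procedures below are chosen so that their `does` parts are, definitionally,
-- isSquare, rectEq, upairEq and rectLt.
square? : ∀ R → Dec (IsSquare R)
square? R = rows R ≟ cols R

_≟ᴿ_ : DecidableEquality Rect
(a , b) ≟ᴿ (c , d) = map′ ≡×≡⇒≡ ≡⇒≡×≡ ((a ≟ c) ×-dec (b ≟ d))

_≟ᵁ_ : DecidableEquality UPair
(X , Y) ≟ᵁ (X′ , Y′) = map′ ≡×≡⇒≡ ≡⇒≡×≡ ((X ≟ᴿ X′) ×-dec (Y ≟ᴿ Y′))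

_<ₗₑₓ_ : Rect → Rect → Set
_<ₗₑₓ_ = ×-Lex _≡_ _<_ _<_

_<ₗₑₓ?_ : ∀ P Q → Dec (P <ₗₑₓ Q)
_<ₗₑₓ?_ = ×-decidable _≟_ _<?_ _<?_

wide≢transpose : ∀ {P Q} → Wide P → Wide Q → P ≢ transpose Q
wide≢transpose P-wide Q-wide refl = <-asym P-wide Q-wide

wide≢square : ∀ {P Q} → Wide P → IsSquare Q → P ≢ Q
wide≢square P-wide Q-square refl = <⇒≢ P-wide Q-square

upair-ordered : ∀ {X Y} → ¬ (Y <ₗₑₓ X) → upair X Y ≡ (X , Y)
upair-ordered {X} {Y} Y≮X = cong (if_then (Y , X) else (X , Y)) (dec-false (Y <ₗₑₓ? X) Y≮X)

upair-swapped : ∀ {X Y} → Y <ₗₑₓ X → upair X Y ≡ (Y , X)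
upair-swapped {X} {Y} Y<X = cong (if_then (Y , X) else (X , Y)) (dec-true (Y <ₗₑₓ? X) Y<X)

upair-cases : ∀ X Y → upair X Y ≡ (X , Y) ⊎ upair X Y ≡ (Y , X)
upair-cases X Y with Y <ₗₑₓ? X
... | yes Y<X = inj₂ (upair-swapped Y<X)
... | no  Y≮X = inj₁ (upair-ordered Y≮X)

upair-comm : ∀ X Y → upair X Y ≡ upair Y X
upair-comm X Y with ×-compare sym <-cmp <-cmp X Y
... | tri< X<Y _ Y≮X         = trans (upair-ordered Y≮X) (sym (upair-swapped X<Y))
... | tri≈ _ (refl , refl) _ = refl
... | tri> X≮Y _ Y<X         = trans (upair-swapped Y<X) (sym (upair-ordered X≮Y))

symmetric⇒upair-invariant : (f : UPair → B) → (∀ X Y → f (X , Y) ≡ f (Y , X)) →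
  ∀ X Y → f (upair X Y) ≡ f (X , Y)
symmetric⇒upair-invariant f f-sym X Y with upair-cases X Y
... | inj₁ ordered = cong f ordered
... | inj₂ swapped = trans (cong f swapped) (f-sym Y X)

upair-injective : ∀ {X Y X′ Y′} → upair X Y ≡ upair X′ Y′ →
  (X ≡ X′ × Y ≡ Y′) ⊎ (X ≡ Y′ × Y ≡ X′)
upair-injective {X} {Y} {X′} {Y′} eq with upair-cases X Y | upair-cases X′ Y′
... | inj₁ p | inj₁ q = inj₁ (≡⇒≡×≡ (trans (sym p) (trans eq q)))
... | inj₁ p | inj₂ q = inj₂ (≡⇒≡×≡ (trans (sym p) (trans eq q)))
... | inj₂ p | inj₁ q = inj₂ (swap (≡⇒≡×≡ (trans (sym p) (trans eq q))))
... | inj₂ p | inj₂ q = inj₁ (swap (≡⇒≡×≡ (trans (sym p) (trans eq q))))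

upair-≢ : ∀ {X Y X′ Y′} → X ≢ X′ ⊎ Y ≢ Y′ → X ≢ Y′ ⊎ Y ≢ X′ → upair X Y ≢ upair X′ Y′
upair-≢ straight crossed eq with upair-injective eq
... | inj₁ (p , q) = [ _$ p , _$ q ] straight
... | inj₂ (p , q) = [ _$ p , _$ q ] crossed

hasSquare transposed sameCols : UPair → Bool
hasSquare  p = isSquare (proj₁ p) ∨ isSquare (proj₂ p)
transposed p = rectEq (proj₁ p) (transpose (proj₂ p))
sameCols   p = cols (proj₁ p) ≡ᵇ cols (proj₂ p)

hasSquare-upair : ∀ P Q → hasSquare (upair P Q) ≡ does (square? P ⊎-dec square? Q)
hasSquare-upair = symmetric⇒upair-invariant hasSquare λ X Y → ∨-comm (isSquare X) (isSquare Y)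

transposed-upair : ∀ P Q → transposed (upair P Q) ≡ does (P ≟ᴿ transpose Q)
transposed-upair = symmetric⇒upair-invariant transposed λ X Y →
  does-⇔ (mk⇔ transpose-swap transpose-swap) (X ≟ᴿ transpose Y) (Y ≟ᴿ transpose X)
  where
  transpose-swap : ∀ {X Y} → X ≡ transpose Y → Y ≡ transpose X
  transpose-swap X≡Yᵀ = cong transpose (sym X≡Yᵀ)

hasSquare-upair-true : ∀ {P Q} → IsSquare P ⊎ IsSquare Q → hasSquare (upair P Q) ≡ true
hasSquare-upair-true {P} {Q} P∨Q-square =
  trans (hasSquare-upair P Q) (dec-true (square? P ⊎-dec square? Q) P∨Q-square)

hasSquare-upair-false : ∀ {P Q} → ¬ IsSquare P → ¬ IsSquare Q → hasSquare (upair P Q) ≡ false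
hasSquare-upair-false {P} {Q} P≠□ Q≠□ =
  trans (hasSquare-upair P Q) (dec-false (square? P ⊎-dec square? Q) [ P≠□ , Q≠□ ])

transposed-upair-true : ∀ {P Q} → P ≡ transpose Q → transposed (upair P Q) ≡ true
transposed-upair-true {P} {Q} P≡Qᵀ =
  trans (transposed-upair P Q) (dec-true (P ≟ᴿ transpose Q) P≡Qᵀ)

transposed-upair-false : ∀ {P Q} → P ≢ transpose Q → transposed (upair P Q) ≡ false
transposed-upair-false {P} {Q} P≢Qᵀ =
  trans (transposed-upair P Q) (dec-false (P ≟ᴿ transpose Q) P≢Qᵀ)

weight : List UPair → ℕ
weight s = length s + count hasSquare s + count transposed s

weight-++ : ∀ xs ys → weight (xs ++ ys) ≡ weight xs + weight ys
weight-++ xs ys = begin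
  length (xs ++ ys) + count hasSquare (xs ++ ys) + count transposed (xs ++ ys)
    ≡⟨ cong₂ (λ l c → l + c + count transposed (xs ++ ys)) (length-++ xs) (count-++ hasSquare xs ys) ⟩
  (l₁ + l₂) + (c₁ + c₂) + count transposed (xs ++ ys)
    ≡⟨ cong₂ _+_ (interchange +-commutativeSemigroup l₁ l₂ c₁ c₂) (count-++ transposed xs ys) ⟩
  ((l₁ + c₁) + (l₂ + c₂)) + (t₁ + t₂)
    ≡⟨ interchange +-commutativeSemigroup (l₁ + c₁) (l₂ + c₂) t₁ t₂ ⟩
  weight xs + weight ys ∎
  where
  l₁ = length xs; l₂ = length ys
  c₁ = count hasSquare xs; c₂ = count hasSquare ys
  t₁ = count transposed xs; t₂ = count transposed ys

weight-values : ∀ xs {cs ts} →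
  Pointwise (λ x c → hasSquare x ≡ c) xs cs → Pointwise (λ x t → transposed x ≡ t) xs ts →
  weight xs ≡ length xs + count id cs + count id ts
weight-values xs squares transposes =
  cong₂ (λ c t → length xs + c + t) (count-values squares) (count-values transposes)

open Deduplication _≟ᵁ_

weight-square-wide : ∀ a Y → Wide Y → weight (deduplicateᵇ upairEq (four ((a , a) , Y))) ≡ 4
weight-square-wide a Y Y-wide = begin
  weight (deduplicateᵇ upairEq (u ∷ v ∷ u ∷ v ∷ []))
    ≡⟨ cong weight (deduplicate-abab u≢v) ⟩
  weight (u ∷ v ∷ [])
    ≡⟨ weight-values (u ∷ v ∷ []) (□u ∷ □v ∷ []) (Tu ∷ Tv ∷ []) ⟩
  4 ∎
  where
  X = (a , a)
  u = upair X Y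
  v = upair X (transpose Y)
  Y≢X : Y ≢ X
  Y≢X = wide≢square Y-wide refl
  u≢v : u ≢ v
  u≢v = upair-≢ (inj₂ (wide≢transpose Y-wide Y-wide)) (inj₂ Y≢X)
  □u = hasSquare-upair-true {X} {Y} (inj₁ refl)
  □v = hasSquare-upair-true {X} {transpose Y} (inj₁ refl)
  Tu = transposed-upair-false {X} {Y} (Y≢X ∘ cong transpose ∘ sym)
  Tv = transposed-upair-false {X} {transpose Y} (≢-sym Y≢X)

weight-wide-square : ∀ X c → Wide X → weight (deduplicateᵇ upairEq (four (X , (c , c)))) ≡ 4
weight-wide-square X c X-wide = begin
  weight (deduplicateᵇ upairEq (u ∷ u ∷ v ∷ v ∷ []))
    ≡⟨ cong weight (deduplicate-aabb u≢v) ⟩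
  weight (u ∷ v ∷ [])
    ≡⟨ weight-values (u ∷ v ∷ []) (□u ∷ □v ∷ []) (Tu ∷ Tv ∷ []) ⟩
  4 ∎
  where
  Y = (c , c)
  u = upair X Y
  v = upair (transpose X) Y
  X≢Y : X ≢ Y
  X≢Y = wide≢square X-wide refl
  u≢v : u ≢ v
  u≢v = upair-≢ (inj₁ (wide≢transpose X-wide X-wide)) (inj₁ X≢Y)
  □u = hasSquare-upair-true {X} {Y} (inj₂ refl)
  □v = hasSquare-upair-true {transpose X} {Y} (inj₂ refl)
  Tu = transposed-upair-false {X} {Y} X≢Y
  Tv = transposed-upair-false {transpose X} {Y} (X≢Y ∘ cong transpose)

weight-twin : ∀ X → Wide X → weight (deduplicateᵇ upairEq (four (X , X))) ≡ 4
weight-twin X X-wide = begin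
  weight (deduplicateᵇ upairEq (u ∷ v ∷ upair Xᵀ X ∷ w ∷ []))
    ≡⟨ cong (λ z → weight (deduplicateᵇ upairEq (u ∷ v ∷ z ∷ w ∷ []))) (upair-comm Xᵀ X) ⟩
  weight (deduplicateᵇ upairEq (u ∷ v ∷ v ∷ w ∷ []))
    ≡⟨ cong weight (deduplicate-abbc u≢v u≢w v≢w) ⟩
  weight (u ∷ v ∷ w ∷ [])
    ≡⟨ weight-values (u ∷ v ∷ w ∷ []) (□u ∷ □v ∷ □w ∷ []) (Tu ∷ Tv ∷ Tw ∷ []) ⟩
  4 ∎
  where
  Xᵀ = transpose X
  u = upair X X
  v = upair X Xᵀ
  w = upair Xᵀ Xᵀ
  X≢Xᵀ : X ≢ Xᵀ
  X≢Xᵀ = wide≢transpose X-wide X-wide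
  u≢v : u ≢ v
  u≢v = upair-≢ (inj₂ X≢Xᵀ) (inj₁ X≢Xᵀ)
  u≢w : u ≢ w
  u≢w = upair-≢ (inj₁ X≢Xᵀ) (inj₁ X≢Xᵀ)
  v≢w : v ≢ w
  v≢w = upair-≢ (inj₁ X≢Xᵀ) (inj₁ X≢Xᵀ)
  X≠□ : ¬ IsSquare X
  X≠□ = <⇒≢ X-wide
  Xᵀ≠□ : ¬ IsSquare Xᵀ
  Xᵀ≠□ = >⇒≢ X-wide
  □u = hasSquare-upair-false {X} {X} X≠□ X≠□
  □v = hasSquare-upair-false {X} {Xᵀ} X≠□ Xᵀ≠□
  □w = hasSquare-upair-false {Xᵀ} {Xᵀ} Xᵀ≠□ Xᵀ≠□
  Tu = transposed-upair-false {X} {X} X≢Xᵀ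
  Tv = transposed-upair-true {X} {Xᵀ} refl
  Tw = transposed-upair-false {Xᵀ} {Xᵀ} (≢-sym X≢Xᵀ)

weight-distinct : ∀ X Y → Wide X → Wide Y → X ≢ Y →
  weight (deduplicateᵇ upairEq (four (X , Y))) ≡ 4
weight-distinct X Y X-wide Y-wide X≢Y = begin
  weight (deduplicateᵇ upairEq (u₁ ∷ u₂ ∷ u₃ ∷ u₄ ∷ []))
    ≡⟨ cong weight (deduplicate-unique distinct) ⟩
  weight (u₁ ∷ u₂ ∷ u₃ ∷ u₄ ∷ [])
    ≡⟨ weight-values (u₁ ∷ u₂ ∷ u₃ ∷ u₄ ∷ []) (□₁ ∷ □₂ ∷ □₃ ∷ □₄ ∷ []) (T₁ ∷ T₂ ∷ T₃ ∷ T₄ ∷ []) ⟩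
  4 ∎
  where
  Xᵀ = transpose X
  Yᵀ = transpose Y
  u₁ = upair X Y
  u₂ = upair X Yᵀ
  u₃ = upair Xᵀ Y
  u₄ = upair Xᵀ Yᵀ
  X≢Xᵀ : X ≢ Xᵀ
  X≢Xᵀ = wide≢transpose X-wide X-wide
  Y≢Yᵀ : Y ≢ Yᵀ
  Y≢Yᵀ = wide≢transpose Y-wide Y-wide
  X≢Yᵀ : X ≢ Yᵀ
  X≢Yᵀ = wide≢transpose X-wide Y-wide
  Y≢Xᵀ : Y ≢ Xᵀ
  Y≢Xᵀ = wide≢transpose Y-wide X-wide
  distinct : Unique (u₁ ∷ u₂ ∷ u₃ ∷ u₄ ∷ [])
  distinct =
      (upair-≢ (inj₂ Y≢Yᵀ) (inj₁ X≢Yᵀ) ∷ upair-≢ (inj₁ X≢Xᵀ) (inj₁ X≢Y) ∷ upair-≢ (inj₁ X≢Xᵀ) (inj₁ X≢Yᵀ) ∷ [])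
    ∷ (upair-≢ (inj₁ X≢Xᵀ) (inj₁ X≢Y) ∷ upair-≢ (inj₁ X≢Xᵀ) (inj₁ X≢Yᵀ) ∷ [])
    ∷ (upair-≢ (inj₂ Y≢Yᵀ) (inj₂ Y≢Xᵀ) ∷ [])
    ∷ []
    ∷ []
  X≠□ : ¬ IsSquare X
  X≠□ = <⇒≢ X-wide
  Xᵀ≠□ : ¬ IsSquare Xᵀ
  Xᵀ≠□ = >⇒≢ X-wide
  Y≠□ : ¬ IsSquare Y
  Y≠□ = <⇒≢ Y-wide
  Yᵀ≠□ : ¬ IsSquare Yᵀ
  Yᵀ≠□ = >⇒≢ Y-wide
  □₁ = hasSquare-upair-false {X} {Y} X≠□ Y≠□
  □₂ = hasSquare-upair-false {X} {Yᵀ} X≠□ Yᵀ≠□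
  □₃ = hasSquare-upair-false {Xᵀ} {Y} Xᵀ≠□ Y≠□
  □₄ = hasSquare-upair-false {Xᵀ} {Yᵀ} Xᵀ≠□ Yᵀ≠□
  T₁ = transposed-upair-false {X} {Y} X≢Yᵀ
  T₂ = transposed-upair-false {X} {Yᵀ} X≢Y
  T₃ = transposed-upair-false {Xᵀ} {Y} (X≢Y ∘ cong transpose)
  T₄ = transposed-upair-false {Xᵀ} {Yᵀ} (≢-sym Y≢Xᵀ)

Canonical : UPair → Set
Canonical (X , Y) = Oriented X × Oriented Y × ¬ (Y <ₗₑₓ X)

weight-block : ∀ {p} → Canonical p → ¬ (IsSquare (proj₁ p) × IsSquare (proj₂ p)) →
  weight (deduplicateᵇ upairEq (four p)) ≡ 4
weight-block {(a , b) , (c , d)} (a≤b , c≤d , _) not-both with a ≟ b | c ≟ d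
... | yes refl | yes refl = contradiction (refl , refl) not-both
... | yes refl | no c≢d   = weight-square-wide a (c , d) (≤∧≢⇒< c≤d c≢d)
... | no a≢b   | yes refl = weight-wide-square (a , b) c (≤∧≢⇒< a≤b a≢b)
... | no a≢b   | no c≢d with (a , b) ≟ᴿ (c , d)
...   | yes refl = weight-twin (a , b) (≤∧≢⇒< a≤b a≢b)
...   | no X≢Y   = weight-distinct (a , b) (c , d) (≤∧≢⇒< a≤b a≢b) (≤∧≢⇒< c≤d c≢d) X≢Y

orient : Rect → Rect
orient R with rows R ≤? cols R
... | yes _ = R
... | no  _ = transpose R

orient-oriented : ∀ {R} → Oriented R → orient R ≡ R
orient-oriented {R} R-oriented with rows R ≤? cols R
... | yes _ = refl
... | no  R-not-oriented = contradiction R-oriented R-not-oriented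

orient-transpose : ∀ {R} → Oriented R → orient (transpose R) ≡ R
orient-transpose {R} R-oriented with cols R ≤? rows R
... | yes Rᵀ-oriented = ≡×≡⇒≡ (≤-antisym Rᵀ-oriented R-oriented , ≤-antisym R-oriented Rᵀ-oriented)
... | no  _ = refl

canonical : UPair → UPair
canonical (U , V) = upair (orient U) (orient V)

canonical-upair : ∀ U V → canonical (upair U V) ≡ canonical (U , V)
canonical-upair = symmetric⇒upair-invariant canonical λ X Y → upair-comm (orient X) (orient Y)

canonical-upair-≡ : ∀ {U V X Y} → ¬ (Y <ₗₑₓ X) → orient U ≡ X → orient V ≡ Y →
  canonical (upair U V) ≡ (X , Y)
canonical-upair-≡ {U} {V} Y≮X U↦X V↦Y =
  trans (canonical-upair U V) (trans (cong₂ upair U↦X V↦Y) (upair-ordered Y≮X))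

canonical-four : ∀ {p x} → Canonical p → x ∈ four p → canonical x ≡ p
canonical-four (X-oriented , Y-oriented , Y≮X) (here refl) =
  canonical-upair-≡ Y≮X (orient-oriented X-oriented) (orient-oriented Y-oriented)
canonical-four (X-oriented , Y-oriented , Y≮X) (there (here refl)) =
  canonical-upair-≡ Y≮X (orient-oriented X-oriented) (orient-transpose Y-oriented)
canonical-four (X-oriented , Y-oriented , Y≮X) (there (there (here refl))) =
  canonical-upair-≡ Y≮X (orient-transpose X-oriented) (orient-oriented Y-oriented)
canonical-four (X-oriented , Y-oriented , Y≮X) (there (there (there (here refl)))) =
  canonical-upair-≡ Y≮X (orient-transpose X-oriented) (orient-transpose Y-oriented)

∈canonicalRects⁻ : ∀ N {R} → R ∈ canonicalRects N → Oriented R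
∈canonicalRects⁻ N {a , b} R∈ =
  ≤ᵇ⇒≤ a b (proj₂ (∈-filter⁻ _ {xs = cartesianProduct (range N) (range N)} R∈))

∈canonicalPairs⁻ : ∀ N {p} → p ∈ canonicalPairs N →
  Canonical p × area (proj₁ p) + area (proj₂ p) ≡ N
∈canonicalPairs⁻ N {X , Y} p∈
  with ∈-filter⁻ _ {xs = cartesianProduct (canonicalRects N) (canonicalRects N)} p∈
... | p∈X×Y , tests
  with ∈-cartesianProduct⁻ (canonicalRects N) (canonicalRects N) p∈X×Y | Equivalence.to T-∧ tests
... | X∈ , Y∈ | area≡N , Y≮X =
  (∈canonicalRects⁻ N X∈ , ∈canonicalRects⁻ N Y∈ , λ Y<X → subst (T ∘ not) (dec-true (Y <ₗₑₓ? X) Y<X) Y≮X)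
  , ≡ᵇ⇒≡ (area X + area Y) N area≡N

canonicalPairs-unique : ∀ N → Unique (canonicalPairs N)
canonicalPairs-unique N = Unique.filter⁺ _ (Unique.cartesianProduct⁺ rects! rects!)
  where
  range! = Unique.map⁺ suc-injective (Unique.upTo⁺ N)
  rects! = Unique.filter⁺ _ (Unique.cartesianProduct⁺ range! range!)

not-both-squares : ∀ {N X Y} → ¬ (∃₂ λ x y → N ≡ x * x + y * y) → area X + area Y ≡ N →
  ¬ (IsSquare X × IsSquare Y)
not-both-squares {X = a , _} {c , _} not-sum area≡N (refl , refl) = not-sum (a , c , sym area≡N)

weight-concatMap : ∀ (f : B → List UPair) (g : B → List A) {ls} →
  All (λ l → weight (f l) ≡ length (g l)) ls → weight (concatMap f ls) ≡ length (concatMap g ls)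
weight-concatMap f g [] = refl
weight-concatMap f g {l ∷ ls} (weight≡length ∷ rest) = begin
  weight (f l ++ concatMap f ls)                ≡⟨ weight-++ (f l) (concatMap f ls) ⟩
  weight (f l) + weight (concatMap f ls)        ≡⟨ cong₂ _+_ weight≡length (weight-concatMap f g rest) ⟩
  length (g l) + length (concatMap g ls)        ≡⟨ length-++ (g l) ⟨
  length (g l ++ concatMap g ls)                ∎

counts≡weight : ∀ s →
  count (not ∘ sameCols) s + count hasSquare s + count sameCols s + count transposed s ≡ weight s
counts≡weight s = begin
  b + c + d + t ≡⟨ cong (_+ t) (xy∙z≈xz∙y +-commutativeSemigroup b c d) ⟩
  b + d + c + t ≡⟨ cong (λ n → n + c + t) (count-complement sameCols s) ⟩
  weight s      ∎
  where
  b = count (not ∘ sameCols) s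
  c = count hasSquare s
  d = count sameCols s
  t = count transposed s

lemma3p1 : (N : ℕ) → ¬ (∃₂ λ x y → N ≡ x * x + y * y) →
    length (𝒜 N) ≡ length (ℬ N) + length (𝒞 N) + length (𝒟 N) + length (ℰ N)
lemma3p1 N not-sum = begin
  length (𝒜 N)
    ≡⟨ weight-concatMap (deduplicateᵇ upairEq ∘ four) four (All.tabulate block-weight) ⟨
  weight (concatMap (deduplicateᵇ upairEq ∘ four) (canonicalPairs N))
    ≡⟨ cong weight (deduplicate-concatMap canonical four (canonicalPairs-unique N) labelled) ⟨
  weight (support𝒜 N)
    ≡⟨ counts≡weight (support𝒜 N) ⟨
  length (ℬ N) + length (𝒞 N) + length (𝒟 N) + length (ℰ N) ∎
  where
  labelled : ∀ {p x} → p ∈ canonicalPairs N → x ∈ four p → canonical x ≡ p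
  labelled p∈ = canonical-four (proj₁ (∈canonicalPairs⁻ N p∈))
  block-weight : ∀ {p} → p ∈ canonicalPairs N →
    weight (deduplicateᵇ upairEq (four p)) ≡ length (four p)
  block-weight p∈ with ∈canonicalPairs⁻ N p∈
  ... | p-canonical , area≡N = weight-block p-canonical (not-both-squares not-sum area≡N)
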